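{- Let $k \ge 1$ and $m \ge 1$ be integers. There exists a bijection between the set $B_{k,m}$ and the set $\{T_k\} \times H_{k,m}$.
   Context: $B_{k,m}$ is the set of partitions $\pi = (\pi_1, \pi_2, \ldots, \pi_k)$ into exactly $k$ distinct odd parts such that $\pi_i - \pi_{i+1} \le 2m$ for all $1 \le i \le k$, with the convention $\pi_{k+1} = 0$ (so in particular the smallest part is at most $2m$). $T_k$ denotes the partition $(2k-1, 2k-3, \ldots, 3, 1)$. $H_{k,m}$ is the set of partitions (including the empty partition) each of whose parts is at most $k$ and in which the multiplicity of each part that occurs is an even number less than $2m$. -}

module Defs where

open import Data.Nat using (ℕ; zero; suc; _+_; _*_; _∸_; _≤_; _<_; _>_; _≥_; _≟_)
open import Data.List using (List; []; _∷_; _++_; [_]; length)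
open import Data.List.Relation.Unary.All using (All)
open import Data.List.Relation.Unary.Linked using (Linked)
open import Data.Product using (Σ; ∃; _×_)
open import Relation.Binary.PropositionalEquality using (_≡_)
open import Relation.Nullary.Decidable using (yes; no)

-- Parity (as witnesses, so these predicates are proof-irrelevant data)
Even : ℕ → Set
Even n = ∃ λ j → n ≡ 2 * j

Odd : ℕ → Set
Odd n = ∃ λ j → n ≡ suc (2 * j)

mult : ℕ → List ℕ → ℕ
mult x [] = 0
mult x (y ∷ l) with x ≟ y
... | yes _ = suc (mult x l)
... | no  _ = mult x l

IsPartition : List ℕ → Set
IsPartition l = Linked _≥_ l × All (λ x → 1 ≤ x) l

-- B_{k,m}: partitions into exactly k distinct odd parts with
-- π_i − π_{i+1} ≤ 2m for 1 ≤ i ≤ k, where π_{k+1} = 0.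
-- Distinct parts of a weakly decreasing list = strictly decreasing.
InB : ℕ → ℕ → List ℕ → Set
InB k m l =
  IsPartition l
  × length l ≡ k
  × Linked _>_ l
  × All Odd l
  × Linked (λ a b → a ∸ b ≤ 2 * m) (l ++ [ 0 ])

B : ℕ → ℕ → Set
B k m = Σ (List ℕ) (InB k m)

T : ℕ → List ℕ
T zero = []
T (suc k) = suc (2 * k) ∷ T k

InH : ℕ → ℕ → List ℕ → Set
InH k m l =
  IsPartition l
  × All (λ x → x ≤ k) l
  × All (λ x → Even (mult x l) × mult x l < 2 * m) l

H : ℕ → ℕ → Set
H k m = Σ (List ℕ) (InH k m)

SingletonT : ℕ → Set
SingletonT k = Σ (List ℕ) (λ p → p ≡ T k)

module Submission where

-- Write π = (π₁ > … > π_k) as π_i = π_{i+1} + 2 + g_i with the convention π_{k+1} = −1,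
-- i.e. the g_i measure how far π exceeds T_k. Oddness of the parts makes every g_i even,
-- and π_i − π_{i+1} ≤ 2m becomes g_i < 2m. Hence π ↦ (the partition having the part
-- k − i + 1 exactly g_i times) maps B_{k,m} onto H_{k,m}; the inverse reads off the
-- multiplicities of k, k − 1, …, 1 and stacks the parts back up.

open import Defs
open import Data.Nat using (ℕ; zero; suc; _+_; _*_; _∸_; _≤_; _<_; _>_; _≥_; _≟_; z≤n; s≤s)
open import Data.Nat.Properties
open import Data.Nat.Tactic.RingSolver using (solve-∀)
open import Data.List using (List; []; _∷_; _++_; [_]; length; replicate)
open import Data.List.Relation.Unary.All as All using (All; []; _∷_)
open import Data.List.Relation.Unary.All.Properties using (++⁺; ++⁻ʳ; replicate⁺)
open import Data.List.Relation.Unary.Linked as Linked using (Linked; []; [-]; _∷_)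
open import Data.List.Relation.Unary.Linked.Properties using (Linked⇒All)
open import Data.Product using (Σ; _×_; _,_; proj₁; proj₂; map₁)
open import Data.Empty using (⊥-elim)
open import Function using (flip)
open import Function.Bundles using (_⤖_; mk↔ₛ′)
open import Function.Properties.Inverse using (↔⇒⤖)
open import Relation.Binary.PropositionalEquality hiding ([_])
open import Relation.Nullary using (yes; no; Irrelevant)

×-irrelevant : {A B : Set} → Irrelevant A → Irrelevant B → Irrelevant (A × B)
×-irrelevant irrA irrB (a , b) (a′ , b′) = cong₂ _,_ (irrA a a′) (irrB b b′)

≡-by-proj₁ : {A : Set} {P : A → Set} → (∀ {a} → Irrelevant (P a)) →
             {a b : A} {pa : P a} {pb : P b} → a ≡ b → _≡_ {A = Σ A P} (a , pa) (b , pb)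
≡-by-proj₁ irr {pa = pa} {pb} refl = cong (_ ,_) (irr pa pb)

even-irrelevant : ∀ {n} → Irrelevant (Even n)
even-irrelevant (i , p) (j , q) with *-cancelˡ-≡ i j 2 (trans (sym p) q)
... | refl = cong (i ,_) (≡-irrelevant p q)

odd-irrelevant : ∀ {n} → Irrelevant (Odd n)
odd-irrelevant (i , p) (j , q) with *-cancelˡ-≡ i j 2 (suc-injective (trans (sym p) q))
... | refl = cong (i ,_) (≡-irrelevant p q)

isPartition-irrelevant : ∀ {l} → Irrelevant (IsPartition l)
isPartition-irrelevant = ×-irrelevant (Linked.irrelevant ≤-irrelevant) (All.irrelevant ≤-irrelevant)

InB-irrelevant : ∀ {k m l} → Irrelevant (InB k m l)
InB-irrelevant = ×-irrelevant isPartition-irrelevant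
  (×-irrelevant ≡-irrelevant (×-irrelevant (Linked.irrelevant <-irrelevant)
  (×-irrelevant (All.irrelevant odd-irrelevant) (Linked.irrelevant ≤-irrelevant))))

InH-irrelevant : ∀ {k m l} → Irrelevant (InH k m l)
InH-irrelevant = ×-irrelevant isPartition-irrelevant
  (×-irrelevant (All.irrelevant ≤-irrelevant)
  (All.irrelevant (×-irrelevant even-irrelevant <-irrelevant)))

Linked-++⁻ʳ : {R : ℕ → ℕ → Set} (xs : List ℕ) {ys : List ℕ} → Linked R (xs ++ ys) → Linked R ys
Linked-++⁻ʳ []       L = L
Linked-++⁻ʳ (_ ∷ xs) L = Linked-++⁻ʳ xs (Linked.tail L)

head-bounds-tail : ∀ {x l} → Linked _≥_ (x ∷ l) → All (_≥_ x) l
head-bounds-tail [-]       = []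
head-bounds-tail (x≥y ∷ L) = Linked⇒All (flip ≤-trans) x≥y L

bounded-∷-Linked : ∀ {a l} → All (_≥_ a) l → Linked _≥_ l → Linked _≥_ (a ∷ l)
bounded-∷-Linked []        [] = [-]
bounded-∷-Linked (a≥y ∷ _) L  = a≥y ∷ L

replicate-++-Linked : ∀ g a {l} → All (_≥_ a) l → Linked _≥_ l → Linked _≥_ (replicate g a ++ l)
replicate-++-Linked zero    a bd L = L
replicate-++-Linked (suc g) a bd L =
  bounded-∷-Linked (++⁺ (replicate⁺ g ≤-refl) bd) (replicate-++-Linked g a bd L)

mult-replicate-++-self : ∀ g a l → mult a (replicate g a ++ l) ≡ g + mult a l
mult-replicate-++-self zero    a l = refl
mult-replicate-++-self (suc g) a l with a ≟ a
... | yes _  = cong suc (mult-replicate-++-self g a l)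
... | no a≢a = ⊥-elim (a≢a refl)

mult-replicate-++-other : ∀ {x} g a l → x ≢ a → mult x (replicate g a ++ l) ≡ mult x l
mult-replicate-++-other         zero    a l x≢a = refl
mult-replicate-++-other {x = x} (suc g) a l x≢a with x ≟ a
... | yes x≡a = ⊥-elim (x≢a x≡a)
... | no _    = mult-replicate-++-other g a l x≢a

mult-above-bound : ∀ k l → All (_≥_ k) l → mult (suc k) l ≡ 0
mult-above-bound k []      []         = refl
mult-above-bound k (y ∷ l) (k≥y ∷ bd) with suc k ≟ y
... | yes refl = ⊥-elim (1+n≰n k≥y)
... | no _     = mult-above-bound k l bd

mult-replicate-++-top : ∀ g k l → All (_≥_ k) l → mult (suc k) (replicate g (suc k) ++ l) ≡ g
mult-replicate-++-top g k l bd = begin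
  mult (suc k) (replicate g (suc k) ++ l) ≡⟨ mult-replicate-++-self g (suc k) l ⟩
  g + mult (suc k) l                      ≡⟨ cong (g +_) (mult-above-bound k l bd) ⟩
  g + 0                                   ≡⟨ +-identityʳ g ⟩
  g                                       ∎
  where open ≡-Reasoning

mult-replicate-++-below : ∀ {y} g k l → y ≤ k → mult y (replicate g (suc k) ++ l) ≡ mult y l
mult-replicate-++-below g k l y≤k = mult-replicate-++-other g (suc k) l (<⇒≢ (s≤s y≤k))

-- The least odd part that may be placed strictly above the (odd, decreasing) parts r.
minAbove : List ℕ → ℕ
minAbove []      = 1
minAbove (y ∷ _) = 2 + y

excess : ℕ → List ℕ → ℕ
excess x r = x ∸ minAbove r

push : ℕ → List ℕ → List ℕ
push c r = (c + minAbove r) ∷ r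

even-<⇒+2-≤ : ∀ a b → 2 * a < 2 * b → 2 + 2 * a ≤ 2 * b
even-<⇒+2-≤ a b 2a<2b = subst (_≤ 2 * b) (*-suc 2 a) (*-monoʳ-≤ 2 (*-cancelˡ-< 2 a b 2a<2b))

minAbove≤head : ∀ x r → Odd x → All Odd r → Linked _>_ (x ∷ r) → minAbove r ≤ x
minAbove≤head _ []      (i , refl) _                _         = s≤s z≤n
minAbove≤head _ (_ ∷ _) (i , refl) ((j , refl) ∷ _) (x>y ∷ _) = s≤s (even-<⇒+2-≤ j i (≤-pred x>y))

excess-even : ∀ x r → Odd x → All Odd r → Even (excess x r)
excess-even _ []      (i , refl) _                = i , refl
excess-even _ (_ ∷ _) (i , refl) ((j , refl) ∷ _) =
  i ∸ suc j , sym (trans (*-distribˡ-∸ 2 i (suc j)) (cong (2 * i ∸_) (*-suc 2 j)))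

excess-push : ∀ c r → excess (c + minAbove r) r ≡ c
excess-push c r = m+n∸n≡m c (minAbove r)

push-excess : ∀ x r → minAbove r ≤ x → push (excess x r) r ≡ x ∷ r
push-excess x r le = cong (_∷ r) (m∸n+n≡m le)

odd-push : ∀ c r → Even c → All Odd r → Odd (c + minAbove r)
odd-push _ []      (a , refl) _                = a , +-comm (2 * a) 1
odd-push _ (_ ∷ _) (a , refl) ((b , refl) ∷ _) = a + suc b , witness a b
  where
  witness : ∀ a b → 2 * a + (2 + suc (2 * b)) ≡ suc (2 * (a + suc b))
  witness = solve-∀

toH : List ℕ → List ℕ
toH []      = []
toH (x ∷ r) = replicate (excess x r) (suc (length r)) ++ toH r

stripLeading : ℕ → List ℕ → ℕ × List ℕ
stripLeading n []      = 0 , []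
stripLeading n (x ∷ l) with n ≟ x
... | yes _ = map₁ suc (stripLeading n l)
... | no  _ = 0 , x ∷ l

toB : ℕ → List ℕ → List ℕ
toB zero    l = []
toB (suc k) l = let (c , l′) = stripLeading (suc k) l in push c (toB k l′)

length-toB : ∀ k l → length (toB k l) ≡ k
length-toB zero    l = refl
length-toB (suc k) l = cong suc (length-toB k _)

stripLeading-++ : ∀ n l → l ≡ replicate (proj₁ (stripLeading n l)) n ++ proj₂ (stripLeading n l)
stripLeading-++ n []      = refl
stripLeading-++ n (x ∷ l) with n ≟ x
... | yes refl = cong (n ∷_) (stripLeading-++ n l)
... | no  _    = refl

stripLeading-bounded : ∀ k l → Linked _≥_ l → All (_≥_ (suc k)) l →
                       All (_≥_ k) (proj₂ (stripLeading (suc k) l))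
stripLeading-bounded k []      L bd = []
stripLeading-bounded k (x ∷ l) L (x≤1+k ∷ bd) with suc k ≟ x
... | yes refl = stripLeading-bounded k l (Linked.tail L) bd
... | no  1+k≢x = x≤k ∷ All.map (λ y≤x → ≤-trans y≤x x≤k) (head-bounds-tail L)
  where x≤k = ≤-pred (≤∧≢⇒< x≤1+k (≢-sym 1+k≢x))

stripLeading-replicate-++ : ∀ k g l → All (_≥_ k) l →
                            stripLeading (suc k) (replicate g (suc k) ++ l) ≡ (g , l)
stripLeading-replicate-++ k zero    []      bd = refl
stripLeading-replicate-++ k zero    (y ∷ l) (k≥y ∷ _) with suc k ≟ y
... | yes refl = ⊥-elim (1+n≰n k≥y)
... | no  _    = refl
stripLeading-replicate-++ k (suc g) l bd with suc k ≟ suc k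
... | yes _    = cong (map₁ suc) (stripLeading-replicate-++ k g l bd)
... | no  k≢k  = ⊥-elim (k≢k refl)

toH-bounded : ∀ π → All (_≥_ (length π)) (toH π)
toH-bounded []      = []
toH-bounded (x ∷ r) = ++⁺ (replicate⁺ (excess x r) ≤-refl) (All.map m≤n⇒m≤1+n (toH-bounded r))

toB∘toH : ∀ {k} π → length π ≡ k → Linked _>_ π → All Odd π → toB k (toH π) ≡ π
toB∘toH []      refl _ _         = refl
toB∘toH (x ∷ r) refl S (ox ∷ O) = begin
  toB (suc n) (replicate g (suc n) ++ toH r)
    ≡⟨ cong (λ (c , l′) → push c (toB n l′)) (stripLeading-replicate-++ n g (toH r) (toH-bounded r)) ⟩
  push g (toB n (toH r)) ≡⟨ cong (push g) (toB∘toH r refl (Linked.tail S) O) ⟩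
  push g r               ≡⟨ push-excess x r (minAbove≤head x r ox O S) ⟩
  x ∷ r                  ∎
  where
  open ≡-Reasoning
  n = length r
  g = excess x r

toH∘toB : ∀ k l → IsPartition l → All (_≥_ k) l → toH (toB k l) ≡ l
toH∘toB zero    []      _              _          = refl
toH∘toB zero    (_ ∷ _) (_ , () ∷ _)   (z≤n ∷ _)
toH∘toB (suc k) l       (L , pos)      bd         = begin
  replicate (excess (c + minAbove r) r) (suc (length r)) ++ toH r
    ≡⟨ cong₂ (λ g n → replicate g (suc n) ++ toH r) (excess-push c r) (length-toB k l′) ⟩
  replicate c (suc k) ++ toH (toB k l′)
    ≡⟨ cong (replicate c (suc k) ++_) (toH∘toB k l′ part′ (stripLeading-bounded k l L bd)) ⟩
  replicate c (suc k) ++ l′ ≡⟨ sym split ⟩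
  l                         ∎
  where
  open ≡-Reasoning
  c = proj₁ (stripLeading (suc k) l)
  l′ = proj₂ (stripLeading (suc k) l)
  r = toB k l′
  split = stripLeading-++ (suc k) l
  part′ : IsPartition l′
  part′ = Linked-++⁻ʳ (replicate c (suc k)) (subst (Linked _≥_) split L)
        , ++⁻ʳ (replicate c (suc k)) (subst (All (1 ≤_)) split pos)

module _ {m : ℕ} where

  Admissible : ℕ → Set
  Admissible g = Even g × g < 2 * m

  AdmissibleMultiplicities : List ℕ → Set
  AdmissibleMultiplicities l = All (λ x → Admissible (mult x l)) l

  module _ {c k : ℕ} {l : List ℕ} (bd : All (_≥_ k) l) where

    admissible-replicate-++⁺ : Admissible c → AdmissibleMultiplicities l →
                               AdmissibleMultiplicities (replicate c (suc k) ++ l)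
    admissible-replicate-++⁺ adm ms =
      ++⁺ (replicate⁺ c (subst Admissible (sym (mult-replicate-++-top c k l bd)) adm))
          (All.zipWith below (ms , bd))
      where
      below : ∀ {y} → Admissible (mult y l) × y ≤ k → Admissible (mult y (replicate c (suc k) ++ l))
      below (a , y≤k) = subst Admissible (sym (mult-replicate-++-below c k l y≤k)) a

    admissible-replicate-++⁻ : 0 < 2 * m → AdmissibleMultiplicities (replicate c (suc k) ++ l) →
                               Admissible c × AdmissibleMultiplicities l
    admissible-replicate-++⁻ 0<2m ms =
      count c ms , All.zipWith below (++⁻ʳ (replicate c (suc k)) ms , bd)
      where
      below : ∀ {y} → Admissible (mult y (replicate c (suc k) ++ l)) × y ≤ k → Admissible (mult y l)
      below (a , y≤k) = subst Admissible (mult-replicate-++-below c k l y≤k) a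
      count : ∀ c → AdmissibleMultiplicities (replicate c (suc k) ++ l) → Admissible c
      count zero    _       = (0 , refl) , 0<2m
      count (suc c) (a ∷ _) = subst Admissible (mult-replicate-++-top (suc c) k l bd) a

    InH-replicate-++⁺ : Admissible c → InH k m l → InH (suc k) m (replicate c (suc k) ++ l)
    InH-replicate-++⁺ adm ((L , pos) , _ , ms) =
      ( (replicate-++-Linked c (suc k) (All.map m≤n⇒m≤1+n bd) L , ++⁺ (replicate⁺ c (s≤s z≤n)) pos)
      , ++⁺ (replicate⁺ c ≤-refl) (All.map m≤n⇒m≤1+n bd)
      , admissible-replicate-++⁺ adm ms )

    InH-replicate-++⁻ : 0 < 2 * m → InH (suc k) m (replicate c (suc k) ++ l) → Admissible c × InH k m l
    InH-replicate-++⁻ 0<2m ((L , pos) , _ , ms) =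
      let (adm , ms′) = admissible-replicate-++⁻ 0<2m ms
      in adm , (Linked-++⁻ʳ (replicate c (suc k)) L , ++⁻ʳ (replicate c (suc k)) pos) , bd , ms′

  -- The gap condition compares x with its successor in r ++ [ 0 ], which lies below minAbove r.
  excess<2m : ∀ x r → minAbove r ≤ x → Linked (λ a b → a ∸ b ≤ 2 * m) (x ∷ r ++ [ 0 ]) →
              excess x r < 2 * m
  excess<2m x []      le (gap ∷ _) = <-≤-trans (∸-monoʳ-< (s≤s z≤n) le) gap
  excess<2m x (y ∷ _) le (gap ∷ _) = <-≤-trans (∸-monoʳ-< (m<n+m y (s≤s z≤n)) le) gap

  InB-∷⁻ : ∀ {k x r} → InB (suc k) m (x ∷ r) → Admissible (excess x r) × InB k m r
  InB-∷⁻ {x = x} {r} ((L , _ ∷ pos) , len , S , ox ∷ O , G) =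
    (excess-even x r ox O , excess<2m x r (minAbove≤head x r ox O S) G)
    , (Linked.tail L , pos) , suc-injective len , Linked.tail S , O , Linked.tail G

  InB-push⁺ : ∀ {k c r} → Admissible c → InB k m r → InB (suc k) m (push c r)
  InB-push⁺ {c = c} {[]} (ev , c<2m) ((_ , _) , len , _ , _ , _) =
    ([-] , m≤n+m 1 c ∷ []) , cong suc len , [-] , odd-push c [] ev [] ∷ []
    , subst (_≤ 2 * m) (+-comm 1 c) c<2m ∷ [-]
  InB-push⁺ {c = c} {y ∷ r} (ev , c<2m) ((L , pos) , len , S , O , G) =
    (y≤top ∷ L , ≤-trans (s≤s z≤n) (m≤n+m (2 + y) c) ∷ pos) , cong suc len , y<top ∷ S
    , odd-push c (y ∷ r) ev O ∷ O , gap ∷ G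
    where
    y<top : y < c + (2 + y)
    y<top = ≤-trans (m<n+m y (s≤s z≤n)) (m≤n+m (2 + y) c)
    y≤top : y ≤ c + (2 + y)
    y≤top = <⇒≤ y<top
    gap : c + (2 + y) ∸ y ≤ 2 * m
    gap = let (a , c≡2a) = ev in begin
      c + (2 + y) ∸ y ≡⟨ cong (_∸ y) (sym (+-assoc c 2 y)) ⟩
      c + 2 + y ∸ y   ≡⟨ m+n∸n≡m (c + 2) y ⟩
      c + 2           ≡⟨ +-comm c 2 ⟩
      2 + c           ≡⟨ cong (2 +_) c≡2a ⟩
      2 + 2 * a       ≤⟨ even-<⇒+2-≤ a m (subst (_< 2 * m) c≡2a c<2m) ⟩
      2 * m           ∎
      where open ≤-Reasoning

  toH-InH : ∀ {k} π → InB k m π → InH k m (toH π)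
  toH-InH []      (_ , refl , _) = ([] , []) , [] , []
  toH-InH (x ∷ r) b@(_ , refl , _) =
    let (adm , b′) = InB-∷⁻ b in InH-replicate-++⁺ (toH-bounded r) adm (toH-InH r b′)

  toB-InB : ∀ {k l} → 0 < 2 * m → InH k m l → InB k m (toB k l)
  toB-InB {zero}      _    _ = ([] , []) , refl , [] , [] , [-]
  toB-InB {suc k} {l} 0<2m h@((L , _) , bd , _) =
    let h″ = subst (InH (suc k) m) (stripLeading-++ (suc k) l) h
        (adm , h′) = InH-replicate-++⁻ bd′ 0<2m h″
    in InB-push⁺ adm (toB-InB 0<2m h′)
    where bd′ = stripLeading-bounded k l L bd

theorem8p1 : (k m : ℕ) → k ≥ 1 → m ≥ 1 → B k m ⤖ (SingletonT k × H k m)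
theorem8p1 k m _ m≥1 = ↔⇒⤖ (mk↔ₛ′ to from to∘from from∘to)
  where
  0<2m : 0 < 2 * m
  0<2m = ≤-trans m≥1 (m≤m+n m (m + 0))
  to : B k m → SingletonT k × H k m
  to (π , b) = (T k , refl) , toH π , toH-InH {m = m} π b
  from : SingletonT k × H k m → B k m
  from (_ , l , h) = toB k l , toB-InB {m = m} 0<2m h
  to∘from : ∀ y → to (from y) ≡ y
  to∘from ((_ , refl) , l , h@(part , bd , _)) =
    cong ((T k , refl) ,_) (≡-by-proj₁ (InH-irrelevant {m = m}) (toH∘toB k l part bd))
  from∘to : ∀ x → from (to x) ≡ x
  from∘to (π , b@(_ , len , S , O , _)) = ≡-by-proj₁ (InB-irrelevant {m = m}) (toB∘toH π len S O)
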